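{- Let $G$ be a non-complete graph such that for any three distinct vertices of $G$, one of which is adjacent to neither of the other two, there exists an induced cycle in $G$ passing through all three vertices. Then $G$ is strongly $2$-monophonic.
   Context: All graphs are finite and simple. For a graph $G$ and $u,v\in V(G)$, the monophonic interval $J_G(u,v)$ is the set of all vertices lying on some induced $u,v$-path in $G$, with the convention $u,v\in J_G(u,v)$ and $J_G(u,u)=\{u\}$. A set $S\subseteq V(G)$ is monophonic if for every $w\in V(G)$ there exist $x,y\in S$ with $w\in J_G(x,y)$; $m(G)$ is the minimum size of a monophonic set. $G$ is $2$-monophonic if $m(G)=2$, and strongly $2$-monophonic if it is $2$-monophonic and $\{x,y\}$ is a monophonic set for every pair of non-adjacent vertices $x,y$. -}

module Defs where

open import Data.Nat using (ℕ; zero; suc; _+_; _≤_; _%_)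
open import Data.Fin using (Fin; toℕ; fromℕ)
open import Data.Fin.Subset using (Subset; _∈_; ⁅_⁆; _∪_; ∣_∣)
open import Data.Product using (Σ; ∃; ∃-syntax; _×_; _,_)
open import Data.Sum using (_⊎_)
open import Relation.Nullary using (¬_; Dec)
open import Relation.Binary.PropositionalEquality using (_≡_; _≢_)
open import Function.Definitions using (Injective)
open import Function.Bundles using (_⇔_)

record Graph : Set₁ where
  field
    n      : ℕ
    Adj    : Fin n → Fin n → Set
    Adj?   : ∀ u v → Dec (Adj u v)
    sym    : ∀ {u v} → Adj u v → Adj v u
    irrefl : ∀ {u} → ¬ Adj u u

module _ (G : Graph) where
  open Graph G

  record InducedPath (l : ℕ) : Set where
    field
      vtx      : Fin (suc l) → Fin n
      distinct : Injective _≡_ _≡_ vtx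
      induced  : ∀ i j → Adj (vtx i) (vtx j) ⇔
                   (toℕ j ≡ suc (toℕ i) ⊎ toℕ i ≡ suc (toℕ j))

  record InducedCycle (m : ℕ) : Set where
    field
      length≥3 : 3 ≤ suc m
      vtx      : Fin (suc m) → Fin n
      distinct : Injective _≡_ _≡_ vtx
      induced  : ∀ i j → Adj (vtx i) (vtx j) ⇔
                   ((toℕ i + 1) % suc m ≡ toℕ j ⊎ (toℕ j + 1) % suc m ≡ toℕ i)

  OnCycle : ∀ {m} → InducedCycle m → Fin n → Set
  OnCycle {k} C w = ∃[ i ] InducedCycle.vtx C i ≡ w

  -- Monophonic interval J_G(u,v): u, v, and every vertex on some induced u,v-path.
  -- (For u = v the only induced u,u-path is the trivial one, so J(u,u) = {u}.)
  InJ : Fin n → Fin n → Fin n → Set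
  InJ u v w = w ≡ u ⊎ w ≡ v ⊎
    (∃[ l ] Σ (InducedPath l) λ P →
       InducedPath.vtx P Data.Fin.zero ≡ u ×
       InducedPath.vtx P (fromℕ l) ≡ v ×
       (∃[ i ] InducedPath.vtx P i ≡ w))

  Monophonic : Subset n → Set
  Monophonic S = ∀ w → ∃[ x ] ∃[ y ] (x ∈ S × y ∈ S × InJ x y w)

  TwoMonophonic : Set
  TwoMonophonic = (∃[ S ] (Monophonic S × ∣ S ∣ ≡ 2))
                × (∀ S → Monophonic S → 2 ≤ ∣ S ∣)

  StronglyTwoMonophonic : Set
  StronglyTwoMonophonic = TwoMonophonic ×
    (∀ x y → x ≢ y → ¬ Adj x y → Monophonic (⁅ x ⁆ ∪ ⁅ y ⁆))

  NonComplete : Set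
  NonComplete = ∃[ x ] ∃[ y ] (x ≢ y × ¬ Adj x y)

  ThreeVertexCycleProperty : Set
  ThreeVertexCycleProperty = ∀ a b c → a ≢ b → a ≢ c → b ≢ c →
    ¬ Adj a b → ¬ Adj a c →
    ∃[ k ] Σ (InducedCycle k) λ C → OnCycle C a × OnCycle C b × OnCycle C c

-- Let x, y be distinct non-adjacent vertices and w any third vertex. If w is
-- adjacent to both, x – w – y is an induced path. Otherwise w is non-adjacent
-- to x or to y, and the hypothesis yields an induced cycle through x, y and w.
-- Since x and y are non-adjacent, each of the two arcs of that cycle between
-- them is an induced path, and w lies on one of them. So {x, y} is monophonic.
-- No single vertex s is monophonic, because J(s, s) = {s} while G has at
-- least two vertices; hence m(G) = 2.
module Submission where

open import Defs
open import Data.Empty using (⊥-elim)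
open import Data.Fin using (Fin; zero; suc; toℕ; fromℕ; fromℕ<; _≟_)
open import Data.Fin.Patterns using (0F; 1F; 2F)
open import Data.Fin.Properties using (toℕ-injective; toℕ-fromℕ<; toℕ-fromℕ; toℕ<n)
open import Data.Fin.Subset using (Subset; _∈_; _⊆_; ⁅_⁆; _∪_; ∣_∣)
open import Data.Fin.Subset.Properties
  using (∪-identityˡ; ∪-identityʳ; ∣⁅x⁆∣≡1; x∈⁅x⁆; x∈⁅y⁆⇒x≡y; x∈p∪q⁺; x∈p∪q⁻; p⊆q⇒∣p∣≤∣q∣)
open import Data.Nat using (ℕ; zero; suc; _+_; _∸_; _≤_; _<_; s≤s; NonZero)
open import Data.Nat.DivMod
  using (_%_; _mod_; %-distribˡ-+; m%n%n≡m%n; [m+n]%n≡m%n; m<n⇒m%n≡m; m%n<n; m%n≤n)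
open import Data.Nat.Properties
  using ( +-commutativeSemigroup; +-comm; +-assoc; +-suc; +-identityʳ; +-cancelˡ-<; m+[n∸m]≡n
        ; m≤n+m; <-cmp; <-trans; ≤-<-trans; <⇒≤; ≤∧≢⇒<)
open import Algebra.Properties.CommutativeSemigroup +-commutativeSemigroup using (x∙yz≈y∙xz)
open import Data.Product using (∃-syntax; _×_; _,_)
open import Data.Sum using (_⊎_; inj₁; inj₂; [_,_])
import Data.Sum as Sum
open import Function using (_∘_)
open import Function.Bundles using (_⇔_; mk⇔; Equivalence)
open import Relation.Binary.Definitions using (tri<; tri≈; tri>)
open import Relation.Binary.PropositionalEquality
  using (_≡_; _≢_; refl; sym; trans; cong; subst; subst₂; module ≡-Reasoning)
open import Relation.Nullary using (¬_; yes; no)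

open ≡-Reasoning

[m%n+o]%n≡[m+o]%n : ∀ m o n .{{_ : NonZero n}} → (m % n + o) % n ≡ (m + o) % n
[m%n+o]%n≡[m+o]%n m o n = begin
  (m % n + o) % n          ≡⟨ %-distribˡ-+ (m % n) o n ⟩
  (m % n % n + o % n) % n  ≡⟨ cong (λ z → (z + o % n) % n) (m%n%n≡m%n m n) ⟩
  (m % n + o % n) % n      ≡⟨ %-distribˡ-+ m o n ⟨
  (m + o) % n              ∎

[m+o%n]%n≡[m+o]%n : ∀ m o n .{{_ : NonZero n}} → (m + o % n) % n ≡ (m + o) % n
[m+o%n]%n≡[m+o]%n m o n = begin
  (m + o % n) % n  ≡⟨ cong (_% n) (+-comm m (o % n)) ⟩
  (o % n + m) % n  ≡⟨ [m%n+o]%n≡[m+o]%n o m n ⟩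
  (o + m) % n      ≡⟨ cong (_% n) (+-comm o m) ⟩
  (m + o) % n      ∎

-- Adding n ∸ a % n undoes adding a.
+-cancelˡ-% : ∀ a u v n .{{_ : NonZero n}} → (a + u) % n ≡ (a + v) % n → u % n ≡ v % n
+-cancelˡ-% a u v n eq = trans (sym (undo u)) (trans (cong (λ z → (z + b) % n) eq) (undo v))
  where
  b = n ∸ a % n
  undo : ∀ x → ((a + x) % n + b) % n ≡ x % n
  undo x = begin
    ((a + x) % n + b) % n  ≡⟨ [m%n+o]%n≡[m+o]%n (a + x) b n ⟩
    (a + x + b) % n        ≡⟨ cong (_% n) (+-assoc a x b) ⟩
    (a + (x + b)) % n      ≡⟨ [m%n+o]%n≡[m+o]%n a (x + b) n ⟨
    (a % n + (x + b)) % n  ≡⟨ cong (_% n) (x∙yz≈y∙xz (a % n) x b) ⟩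
    (x + (a % n + b)) % n  ≡⟨ cong (λ z → (x + z) % n) (m+[n∸m]≡n (m%n≤n a n)) ⟩
    (x + n) % n            ≡⟨ [m+n]%n≡m%n x n ⟩
    x % n                  ∎

+-cancelˡ-%-< : ∀ a {u v n} .{{_ : NonZero n}} → u < n → v < n →
                (a + u) % n ≡ (a + v) % n → u ≡ v
+-cancelˡ-%-< a {u} {v} {n} u<n v<n eq = begin
  u      ≡⟨ m<n⇒m%n≡m u<n ⟨
  u % n  ≡⟨ +-cancelˡ-% a u v n eq ⟩
  v % n  ≡⟨ m<n⇒m%n≡m v<n ⟩
  v      ∎

∣⁅x⁆∪⁅y⁆∣≡2 : ∀ {n} {x y : Fin n} → x ≢ y → ∣ ⁅ x ⁆ ∪ ⁅ y ⁆ ∣ ≡ 2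
∣⁅x⁆∪⁅y⁆∣≡2 {x = zero}  {zero}  x≢y = ⊥-elim (x≢y refl)
∣⁅x⁆∪⁅y⁆∣≡2 {x = zero}  {suc y} _   rewrite ∪-identityˡ ⁅ y ⁆ = cong suc (∣⁅x⁆∣≡1 y)
∣⁅x⁆∪⁅y⁆∣≡2 {x = suc x} {zero}  _   rewrite ∪-identityʳ ⁅ x ⁆ = cong suc (∣⁅x⁆∣≡1 x)
∣⁅x⁆∪⁅y⁆∣≡2 {x = suc x} {suc y} x≢y = ∣⁅x⁆∪⁅y⁆∣≡2 (x≢y ∘ cong suc)

x∈p∧y∈p∧x≢y⇒2≤∣p∣ : ∀ {n} {p : Subset n} {x y} → x ∈ p → y ∈ p → x ≢ y → 2 ≤ ∣ p ∣
x∈p∧y∈p∧x≢y⇒2≤∣p∣ {p = p} {x} {y} x∈p y∈p x≢y =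
  subst (_≤ ∣ p ∣) (∣⁅x⁆∪⁅y⁆∣≡2 x≢y) (p⊆q⇒∣p∣≤∣q∣ pair⊆p)
  where
  pair⊆p : ⁅ x ⁆ ∪ ⁅ y ⁆ ⊆ p
  pair⊆p z∈ = [ (λ z∈⁅x⁆ → subst (_∈ p) (sym (x∈⁅y⁆⇒x≡y x z∈⁅x⁆)) x∈p)
              , (λ z∈⁅y⁆ → subst (_∈ p) (sym (x∈⁅y⁆⇒x≡y y z∈⁅y⁆)) y∈p)
              ] (x∈p∪q⁻ ⁅ x ⁆ ⁅ y ⁆ z∈)

module _ (G : Graph) where
  open Graph G renaming (sym to Adj-sym)

  module Arcs {m : ℕ} (C : InducedCycle G m) where
    open InducedCycle C

    k : ℕ
    k = suc m

    at : ℕ → Fin n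
    at u = vtx (u mod k)

    toℕ-mod : ∀ u → toℕ (u mod k) ≡ u % k
    toℕ-mod u = toℕ-fromℕ< (m%n<n u k)

    at-cong : ∀ u v → u % k ≡ v % k → at u ≡ at v
    at-cong u v eq = cong vtx (toℕ-injective (trans (toℕ-mod u) (trans eq (sym (toℕ-mod v)))))

    at-injective : ∀ u v → at u ≡ at v → u % k ≡ v % k
    at-injective u v eq = trans (sym (toℕ-mod u)) (trans (cong toℕ (distinct eq)) (toℕ-mod v))

    at-toℕ : ∀ f → at (toℕ f) ≡ vtx f
    at-toℕ f = cong vtx (toℕ-injective (trans (toℕ-mod (toℕ f)) (m<n⇒m%n≡m (toℕ<n f))))

    toℕ-mod-successor : ∀ u → (toℕ (u mod k) + 1) % k ≡ suc u % k
    toℕ-mod-successor u = begin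
      (toℕ (u mod k) + 1) % k  ≡⟨ cong (λ z → (z + 1) % k) (toℕ-mod u) ⟩
      (u % k + 1) % k          ≡⟨ [m%n+o]%n≡[m+o]%n u 1 k ⟩
      (u + 1) % k              ≡⟨ cong (_% k) (+-comm u 1) ⟩
      suc u % k                ∎

    at-adjacent : ∀ u v → suc u % k ≡ v % k → Adj (at u) (at v)
    at-adjacent u v eq = Equivalence.from (induced (u mod k) (v mod k))
      (inj₁ (trans (toℕ-mod-successor u) (trans eq (sym (toℕ-mod v)))))

    adjacent-at : ∀ u v → Adj (at u) (at v) → suc u % k ≡ v % k ⊎ suc v % k ≡ u % k
    adjacent-at u v adj = Sum.map (successor u v) (successor v u)
                                  (Equivalence.to (induced (u mod k) (v mod k)) adj)
      where
      successor : ∀ u v → (toℕ (u mod k) + 1) % k ≡ toℕ (v mod k) → suc u % k ≡ v % k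
      successor u v eq = trans (sym (toℕ-mod-successor u)) (trans eq (toℕ-mod v))

    -- The positions a, a + 1, …, a + d; the bound keeps the two ends non-adjacent.
    arc : ∀ a d → suc d < k → InducedPath G d
    arc a d sd<k = record
      { vtx      = λ t → at (a + toℕ t)
      ; distinct = distinct′
      ; induced  = λ s t → mk⇔ (Sum.map (successor s t) (successor t s) ∘ adjacent-at _ _)
                                [ consecutive s t , Adj-sym ∘ consecutive t s ]
      }
      where
      bound : ∀ (t : Fin (suc d)) → toℕ t < k
      bound t = <-trans (toℕ<n t) sd<k

      distinct′ : ∀ {s t} → at (a + toℕ s) ≡ at (a + toℕ t) → s ≡ t
      distinct′ {s} {t} eq = toℕ-injective
        (+-cancelˡ-%-< a (bound s) (bound t) (at-injective (a + toℕ s) (a + toℕ t) eq))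

      successor : ∀ s t → suc (a + toℕ s) % k ≡ (a + toℕ t) % k → toℕ t ≡ suc (toℕ s)
      successor s t eq = sym (+-cancelˡ-%-< a (≤-<-trans (toℕ<n s) sd<k) (bound t)
                                            (trans (cong (_% k) (+-suc a (toℕ s))) eq))

      consecutive : ∀ s t → toℕ t ≡ suc (toℕ s) → Adj (at (a + toℕ s)) (at (a + toℕ t))
      consecutive s t eq = at-adjacent (a + toℕ s) (a + toℕ t)
        (cong (_% k) (trans (sym (+-suc a (toℕ s))) (cong (a +_) (sym eq))))

    arc-InJ : ∀ a {d e} → suc d < k → e ≤ d → InJ G (at a) (at (a + d)) (at (a + e))
    arc-InJ a {d} sd<k e≤d = inj₂ (inj₂
      ( d , arc a d sd<k
      , cong at (+-identityʳ a)
      , cong (λ z → at (a + z)) (toℕ-fromℕ d)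
      , fromℕ< (s≤s e≤d) , cong (λ z → at (a + z)) (toℕ-fromℕ< (s≤s e≤d))))

    -- Non-adjacency forces 2 ≤ d ≤ k − 2; then w lies on the arc from x to y or
    -- on the arc from y around to x.
    cycle-InJ : ∀ a {d e x y w} → d < k → e < k →
                at a ≡ x → at (a + d) ≡ y → at (a + e) ≡ w →
                ¬ Adj x y → x ≢ y → x ≢ w → y ≢ w → InJ G x y w ⊎ InJ G y x w
    cycle-InJ a {zero} _ _ refl refl refl _ x≢y _ _ = ⊥-elim (x≢y (cong at (sym (+-identityʳ a))))
    cycle-InJ a {suc zero} _ _ refl refl refl ¬x~y _ _ _ =
      ⊥-elim (¬x~y (at-adjacent a (a + 1) (cong (_% k) (+-comm 1 a))))
    cycle-InJ a {d@(suc (suc d′))} {e} d<k e<k refl refl refl ¬x~y _ _ y≢w with <-cmp e d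
    ... | tri< e<d _ _ = inj₁ (arc-InJ a (≤∧≢⇒< d<k d+1≢k) (<⇒≤ e<d))
      where
      d+1≢k : suc d ≢ k
      d+1≢k eq = ¬x~y (Adj-sym (at-adjacent (a + d) a (begin
        suc (a + d) % k  ≡⟨ cong (_% k) (trans (sym (+-suc a d)) (cong (a +_) eq)) ⟩
        (a + k) % k      ≡⟨ [m+n]%n≡m%n a k ⟩
        a % k            ∎)))
    ... | tri≈ _ refl _ = ⊥-elim (y≢w refl)
    ... | tri> _ _ d<e =
      inj₂ (subst₂ (InJ G (at (a + d))) x≡ w≡ (arc-InJ (a + d) sL<k (<⇒≤ e′<L)))
      where
      L  = k ∸ d
      e′ = e ∸ d
      d+L≡k : d + L ≡ k
      d+L≡k = m+[n∸m]≡n (<⇒≤ d<k)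
      d+e′≡e : d + e′ ≡ e
      d+e′≡e = m+[n∸m]≡n (<⇒≤ d<e)
      sL<k : suc L < k
      sL<k = subst (suc L <_) d+L≡k (s≤s (s≤s (m≤n+m L d′)))
      e′<L : e′ < L
      e′<L = +-cancelˡ-< d e′ L (subst₂ _<_ (sym d+e′≡e) (sym d+L≡k) e<k)
      x≡ : at (a + d + L) ≡ at a
      x≡ = at-cong (a + d + L) a (begin
        (a + d + L) % k  ≡⟨ cong (_% k) (trans (+-assoc a d L) (cong (a +_) d+L≡k)) ⟩
        (a + k) % k      ≡⟨ [m+n]%n≡m%n a k ⟩
        a % k            ∎)
      w≡ : at (a + d + e′) ≡ at (a + e)
      w≡ = cong at (trans (+-assoc a d e′) (cong (a +_) d+e′≡e))

    offset : ∀ i f → ∃[ d ] (d < k × at (toℕ i + d) ≡ vtx f)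
    offset i f = d , m%n<n (toℕ f + (k ∸ toℕ i)) k
               , trans (at-cong (toℕ i + d) (toℕ f) position) (at-toℕ f)
      where
      d = (toℕ f + (k ∸ toℕ i)) % k
      i+[k∸i]≡k : toℕ i + (k ∸ toℕ i) ≡ k
      i+[k∸i]≡k = m+[n∸m]≡n (<⇒≤ (toℕ<n i))
      position : (toℕ i + d) % k ≡ toℕ f % k
      position = begin
        (toℕ i + d) % k                      ≡⟨ [m+o%n]%n≡[m+o]%n (toℕ i) _ k ⟩
        (toℕ i + (toℕ f + (k ∸ toℕ i))) % k  ≡⟨ cong (_% k) (x∙yz≈y∙xz (toℕ i) (toℕ f) _) ⟩
        (toℕ f + (toℕ i + (k ∸ toℕ i))) % k  ≡⟨ cong (λ z → (toℕ f + z) % k) i+[k∸i]≡k ⟩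
        (toℕ f + k) % k                      ≡⟨ [m+n]%n≡m%n (toℕ f) k ⟩
        toℕ f % k                            ∎

    onCycle-InJ : ∀ {x y w} → OnCycle G C x → OnCycle G C y → OnCycle G C w →
                  ¬ Adj x y → x ≢ y → x ≢ w → y ≢ w → InJ G x y w ⊎ InJ G y x w
    onCycle-InJ (i , x≡) (j , y≡) (h , w≡) with offset i j | offset i h
    ... | d , d<k , at-d | e , e<k , at-e =
      cycle-InJ (toℕ i) d<k e<k (trans (at-toℕ i) x≡) (trans at-d y≡) (trans at-e w≡)

  InJ-diagonal : ∀ {s w} → InJ G s s w → w ≡ s
  InJ-diagonal (inj₁ w≡s)                                     = w≡s
  InJ-diagonal (inj₂ (inj₁ w≡s))                              = w≡s
  InJ-diagonal (inj₂ (inj₂ (zero , _ , start , _ , 0F , w≡))) = trans (sym w≡) start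
  InJ-diagonal (inj₂ (inj₂ (suc l , P , start , end , _)))
    with InducedPath.distinct P (trans start (sym end))
  ... | ()

  path₃-InJ : ∀ {x y w} → x ≢ y → ¬ Adj x y → Adj x w → Adj w y → InJ G x y w
  path₃-InJ {x} {y} {w} x≢y ¬x~y x~w w~y = inj₂ (inj₂ (2 , P , refl , refl , 1F , refl))
    where
    vtx : Fin 3 → Fin n
    vtx 0F = x
    vtx 1F = w
    vtx 2F = y

    adjacent⇒≢ : ∀ {u v} → Adj u v → u ≢ v
    adjacent⇒≢ u~v refl = irrefl u~v

    distinct : ∀ {s t} → vtx s ≡ vtx t → s ≡ t
    distinct {0F} {0F} _  = refl
    distinct {0F} {1F} eq = ⊥-elim (adjacent⇒≢ x~w eq)
    distinct {0F} {2F} eq = ⊥-elim (x≢y eq)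
    distinct {1F} {0F} eq = ⊥-elim (adjacent⇒≢ x~w (sym eq))
    distinct {1F} {1F} _  = refl
    distinct {1F} {2F} eq = ⊥-elim (adjacent⇒≢ w~y eq)
    distinct {2F} {0F} eq = ⊥-elim (x≢y (sym eq))
    distinct {2F} {1F} eq = ⊥-elim (adjacent⇒≢ w~y (sym eq))
    distinct {2F} {2F} _  = refl

    induced : ∀ s t → Adj (vtx s) (vtx t) ⇔ (toℕ t ≡ suc (toℕ s) ⊎ toℕ s ≡ suc (toℕ t))
    induced 0F 1F = mk⇔ (λ _ → inj₁ refl) (λ _ → x~w)
    induced 1F 0F = mk⇔ (λ _ → inj₂ refl) (λ _ → Adj-sym x~w)
    induced 1F 2F = mk⇔ (λ _ → inj₁ refl) (λ _ → w~y)
    induced 2F 1F = mk⇔ (λ _ → inj₂ refl) (λ _ → Adj-sym w~y)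
    induced 0F 0F = mk⇔ (⊥-elim ∘ irrefl) λ { (inj₁ ()) ; (inj₂ ()) }
    induced 1F 1F = mk⇔ (⊥-elim ∘ irrefl) λ { (inj₁ ()) ; (inj₂ ()) }
    induced 2F 2F = mk⇔ (⊥-elim ∘ irrefl) λ { (inj₁ ()) ; (inj₂ ()) }
    induced 0F 2F = mk⇔ (⊥-elim ∘ ¬x~y) λ { (inj₁ ()) ; (inj₂ ()) }
    induced 2F 0F = mk⇔ (⊥-elim ∘ ¬x~y ∘ Adj-sym) λ { (inj₁ ()) ; (inj₂ ()) }

    P : InducedPath G 2
    P = record { vtx = vtx ; distinct = distinct ; induced = induced }

  nonadjacent-InJ : ThreeVertexCycleProperty G → ∀ {x y} → x ≢ y → ¬ Adj x y →
                    ∀ w → InJ G x y w ⊎ InJ G y x w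
  nonadjacent-InJ cycle {x} {y} x≢y ¬x~y w with w ≟ x | w ≟ y
  ... | yes w≡x | _       = inj₁ (inj₁ w≡x)
  ... | no _    | yes w≡y = inj₁ (inj₂ (inj₁ w≡y))
  ... | no w≢x  | no w≢y with Adj? x w | Adj? y w
  ... | no ¬x~w | _ with cycle x y w x≢y (w≢x ∘ sym) (w≢y ∘ sym) ¬x~y ¬x~w
  ...   | _ , C , on-x , on-y , on-w =
          Arcs.onCycle-InJ C on-x on-y on-w ¬x~y x≢y (w≢x ∘ sym) (w≢y ∘ sym)
  nonadjacent-InJ cycle {x} {y} x≢y ¬x~y w | no w≢x | no w≢y | yes _ | no ¬y~w
    with cycle y x w (x≢y ∘ sym) (w≢y ∘ sym) (w≢x ∘ sym) (¬x~y ∘ Adj-sym) ¬y~w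
  ...   | _ , C , on-y , on-x , on-w =
          Arcs.onCycle-InJ C on-x on-y on-w ¬x~y x≢y (w≢x ∘ sym) (w≢y ∘ sym)
  nonadjacent-InJ cycle x≢y ¬x~y w | no _ | no _ | yes x~w | yes y~w =
    inj₁ (path₃-InJ x≢y ¬x~y x~w (Adj-sym y~w))

  pair-monophonic : ThreeVertexCycleProperty G → ∀ x y → x ≢ y → ¬ Adj x y →
                    Monophonic G (⁅ x ⁆ ∪ ⁅ y ⁆)
  pair-monophonic cycle x y x≢y ¬x~y w = cover (nonadjacent-InJ cycle x≢y ¬x~y w)
    where
    x∈ : x ∈ ⁅ x ⁆ ∪ ⁅ y ⁆
    x∈ = x∈p∪q⁺ (inj₁ (x∈⁅x⁆ x))
    y∈ : y ∈ ⁅ x ⁆ ∪ ⁅ y ⁆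
    y∈ = x∈p∪q⁺ {p = ⁅ x ⁆} (inj₂ (x∈⁅x⁆ y))
    cover : InJ G x y w ⊎ InJ G y x w →
            ∃[ u ] ∃[ v ] (u ∈ ⁅ x ⁆ ∪ ⁅ y ⁆ × v ∈ ⁅ x ⁆ ∪ ⁅ y ⁆ × InJ G u v w)
    cover (inj₁ w∈J) = x , y , x∈ , y∈ , w∈J
    cover (inj₂ w∈J) = y , x , y∈ , x∈ , w∈J

  monophonic⇒2≤∣S∣ : ∀ {x y} → x ≢ y → ∀ S → Monophonic G S → 2 ≤ ∣ S ∣
  monophonic⇒2≤∣S∣ {x} {y} x≢y S mono with member-or-2≤∣S∣ x | member-or-2≤∣S∣ y
    where
    member-or-2≤∣S∣ : ∀ v → v ∈ S ⊎ 2 ≤ ∣ S ∣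
    member-or-2≤∣S∣ v with mono v
    ... | a , b , a∈S , b∈S , v∈J with a ≟ b
    ...   | yes refl = inj₁ (subst (_∈ S) (sym (InJ-diagonal v∈J)) a∈S)
    ...   | no a≢b   = inj₂ (x∈p∧y∈p∧x≢y⇒2≤∣p∣ a∈S b∈S a≢b)
  ... | inj₁ x∈S | inj₁ y∈S = x∈p∧y∈p∧x≢y⇒2≤∣p∣ x∈S y∈S x≢y
  ... | inj₂ 2≤  | _        = 2≤
  ... | inj₁ _   | inj₂ 2≤  = 2≤

proposition3p3 : (G : Graph) → NonComplete G → ThreeVertexCycleProperty G →
    StronglyTwoMonophonic G
proposition3p3 G (x , y , x≢y , ¬x~y) cycle =
  ( (⁅ x ⁆ ∪ ⁅ y ⁆ , pair-monophonic G cycle x y x≢y ¬x~y , ∣⁅x⁆∪⁅y⁆∣≡2 x≢y)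
  , monophonic⇒2≤∣S∣ G x≢y )
  , pair-monophonic G cycle
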